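{- Let $T$ be any ABT and $t\neq f$ a vertex of $T$ such that $T(t)$ has at least one incoming edge. Then $\mathrm{dist}^{\alpha}(t)+\mathrm{dist}^{\beta}(t)\ge \mathsf{vlevel}(e^*_T(t))$.
   Context: $G$ finite simple graph, $M$ a matching, $U$ the $M$-uncovered vertices. $G^+$: add vertex $f$ and for each $u\in U$ a vertex $w_u$ with edges $\{f,w_u\},\{w_u,u\}$; $M^+=M\cup\{\{w_u,u\}\}$. Alternating path: simple path in $G^+$ alternating between $M^+$ and non-$M^+$ edges. $\mathrm{dist}^\theta(v)$: minimum length of an alternating $f$–$v$ path of parity $\theta\in\{\mathrm{odd},\mathrm{even}\}$ ($\infty$ if none). $\mathrm{dist}^\alpha(v)$, $\mathrm{dist}^\beta(v)$: min and max of the two; $\alpha(v)$ the parity attaining the min. $\rho(e)=\mathrm{odd}$ if $e\in M^+$, else even. $\mathsf{P}(u)$: vertices $u'$ such that some alternating $f$–$u$ path of length $\mathrm{dist}^\alpha(u)$ ends with edge $\{u',u\}$. An ABT is a tree $T$ rooted at $f$ on the vertices with $\mathrm{dist}^\alpha<\infty$ with each $u\neq f$ having parent $\mathsf{p}_T(u)\in\mathsf{P}(u)$; $T(t)$ is the subtree at $t$. An incoming edge of $T(t)$ is an edge of $G^+$ not in $T$ with exactly one endpoint in $T(t)$. For $e=\{y,z\}$: $\mathsf{vlevel}(e)=\mathrm{dist}^{\rho(e)}(y)+\mathrm{dist}^{\rho(e)}(z)+1$, $\mathsf{hlevel}(e)=\max\{\mathrm{dist}^{\rho(e)}(y),\mathrm{dist}^{\rho(e)}(z)\}$;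 levels are compared lexicographically by $(\mathsf{vlevel},\mathsf{hlevel})$. $e^*_T(t)$ is a fixed minimum-level incoming edge of $T(t)$. -}

module Defs where

open import Data.Nat using (ℕ; zero; suc; _+_; _<_; _≤_; _⊔_; _⊓_)
open import Data.Fin using (Fin)
open import Data.Fin.Properties using () renaming (_≟_ to _≟F_)
open import Data.Bool using (Bool; true; false; not; _∧_; _∨_; T; if_then_else_)
open import Data.List using (List; []; _∷_; _++_; [_]; length; map; allFin)
open import Data.Bool.ListAction using (or)
open import Data.List.Relation.Unary.Unique.Propositional using (Unique)
open import Data.Product using (Σ; ∃; _×_; _,_)
open import Data.Sum using (_⊎_)
open import Data.Unit using (⊤)
open import Data.Empty using (⊥)
open import Relation.Nullary using (¬_; does)
open import Relation.Binary.PropositionalEquality using (_≡_; _≢_)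

data ℕ∞ : Set where
  fin : ℕ → ℕ∞
  ∞   : ℕ∞

_+∞_ : ℕ∞ → ℕ∞ → ℕ∞
fin a +∞ fin b = fin (a + b)
_     +∞ _     = ∞

min∞ : ℕ∞ → ℕ∞ → ℕ∞
min∞ (fin a) (fin b) = fin (a ⊓ b)
min∞ (fin a) ∞       = fin a
min∞ ∞       y       = y

max∞ : ℕ∞ → ℕ∞ → ℕ∞
max∞ (fin a) (fin b) = fin (a ⊔ b)
max∞ _       _       = ∞

data _≤∞_ : ℕ∞ → ℕ∞ → Set where
  fin≤fin : ∀ {a b} → a ≤ b → fin a ≤∞ fin b
  _≤∞∞    : ∀ x → x ≤∞ ∞

data _<∞_ : ℕ∞ → ℕ∞ → Set where
  fin<fin : ∀ {a b} → a < b → fin a <∞ fin b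
  fin<∞   : ∀ {a} → fin a <∞ ∞

IsFin : ℕ∞ → Set
IsFin (fin _) = ⊤
IsFin ∞       = ⊥

data Parity : Set where
  odd even : Parity

flip : Parity → Parity
flip odd  = even
flip even = odd

parityOf : ℕ → Parity
parityOf zero    = even
parityOf (suc k) = flip (parityOf k)

IsSimpleGraph : ∀ {n} → (Fin n → Fin n → Bool) → Set
IsSimpleGraph {n} adj =
  (∀ (a b : Fin n) → adj a b ≡ adj b a) × (∀ (a : Fin n) → adj a a ≡ false)

IsMatching : ∀ {n} → (Fin n → Fin n → Bool) → (Fin n → Fin n → Bool) → Set
IsMatching {n} adj mat =
  (∀ (a b : Fin n) → T (mat a b) → T (adj a b))
  × (∀ (a b : Fin n) → mat a b ≡ mat b a)
  × (∀ (a b c : Fin n) → T (mat a b) → T (mat a c) → b ≡ c)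

-- The vertex w u is joined (to f and to u) only when u is
-- M-uncovered; for covered u it is an isolated dummy vertex (harmless).

data V⁺ (n : ℕ) : Set where
  orig : Fin n → V⁺ n
  f    : V⁺ n
  w    : Fin n → V⁺ n

module _ {n : ℕ} (adj mat : Fin n → Fin n → Bool) where

  uncov : Fin n → Bool
  uncov u = not (or (map (mat u) (allFin n)))

  E⁺ : V⁺ n → V⁺ n → Bool
  E⁺ (orig a) (orig b) = adj a b
  E⁺ f        (w u)    = uncov u
  E⁺ (w u)    f        = uncov u
  E⁺ (w u)    (orig v) = does (u ≟F v) ∧ uncov u
  E⁺ (orig v) (w u)    = does (u ≟F v) ∧ uncov u
  E⁺ _        _        = false

  M⁺ : V⁺ n → V⁺ n → Bool
  M⁺ (orig a) (orig b) = mat a b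
  M⁺ (w u)    (orig v) = does (u ≟F v) ∧ uncov u
  M⁺ (orig v) (w u)    = does (u ≟F v) ∧ uncov u
  M⁺ _        _        = false

  ρ : V⁺ n → V⁺ n → Parity
  ρ y z = if M⁺ y z then odd else even

  Edges : List (V⁺ n) → Set
  Edges (x ∷ y ∷ r) = T (E⁺ x y) × Edges (y ∷ r)
  Edges _           = ⊤

  Alternates : List (V⁺ n) → Set
  Alternates (x ∷ y ∷ z ∷ r) =
    ((T (M⁺ x y) × ¬ T (M⁺ y z)) ⊎ (¬ T (M⁺ x y) × T (M⁺ y z)))
    × Alternates (y ∷ z ∷ r)
  Alternates _ = ⊤

  -- The alternating f–v path with vertex sequence f ∷ q (length = length q)
  AltPath : V⁺ n → List (V⁺ n) → Set
  AltPath v q =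
    (∃ λ pre → f ∷ q ≡ pre ++ [ v ])
    × Edges (f ∷ q) × Alternates (f ∷ q) × Unique (f ∷ q)

  IsDist : Parity → V⁺ n → ℕ∞ → Set
  IsDist θ v (fin d) =
    (∃ λ q → AltPath v q × length q ≡ d × parityOf d ≡ θ)
    × (∀ q → AltPath v q → parityOf (length q) ≡ θ → d ≤ length q)
  IsDist θ v ∞ =
    ∀ q → AltPath v q → ¬ (parityOf (length q) ≡ θ)

  module _ (dist : Parity → V⁺ n → ℕ∞) where

    distα distβ : V⁺ n → ℕ∞
    distα v = min∞ (dist odd v) (dist even v)
    distβ v = max∞ (dist odd v) (dist even v)

    InP : V⁺ n → V⁺ n → Set
    InP u u' = ∃ λ q → AltPath u q × fin (length q) ≡ distα u
                 × ∃ λ pre → f ∷ q ≡ pre ++ (u' ∷ u ∷ [])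

    InT : V⁺ n → Set
    InT v = IsFin (distα v)

    vlevel hlevel : V⁺ n → V⁺ n → ℕ∞
    vlevel y z = (dist (ρ y z) y +∞ dist (ρ y z) z) +∞ fin 1
    hlevel y z = max∞ (dist (ρ y z) y) (dist (ρ y z) z)

    LevelLE : V⁺ n → V⁺ n → V⁺ n → V⁺ n → Set
    LevelLE y z y' z' =
      (vlevel y z <∞ vlevel y' z')
      ⊎ (vlevel y z ≡ vlevel y' z' × hlevel y z ≤∞ hlevel y' z')

    module _ (par : V⁺ n → V⁺ n) where

      data Desc (t : V⁺ n) : V⁺ n → Set where
        here  : Desc t t
        there : ∀ {v} → v ≢ f → Desc t (par v) → Desc t v

      -- par is the parent function of an ABT: a tree rooted at f on the
      -- vertices of finite dist^α, each non-root u having parent in P(u)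
      IsABT : Set
      IsABT = (∀ u → InT u → u ≢ f → InP u (par u))
            × (∀ u → InT u → Desc f u)

      Sub : V⁺ n → V⁺ n → Set
      Sub t v = InT v × Desc t v

      TreeEdge : V⁺ n → V⁺ n → Set
      TreeEdge y z = (InT z × z ≢ f × par z ≡ y) ⊎ (InT y × y ≢ f × par y ≡ z)

      Incoming : V⁺ n → V⁺ n → V⁺ n → Set
      Incoming t y z = T (E⁺ y z) × ¬ TreeEdge y z × Sub t y × ¬ Sub t z

      MinIncoming : V⁺ n → V⁺ n → V⁺ n → Set
      MinIncoming t y z = Incoming t y z
        × (∀ y' z' → Incoming t y' z' → LevelLE y z y' z')

{-# OPTIONS --safe #-}
module Submission where

-- Let Q be an alternating f–t path of length dist^α(t) and P one of the
-- opposite parity, of length dist^β(t).  Every vertex of T(t) other than t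
-- has larger dist^α than t, so Q meets T(t) only in t.  Let {z, y} be the
-- last edge on which P enters T(t).  Following Q to t and then P backwards
-- from t to y is again an alternating path, and because Q and P have opposite
-- parities it reaches y with parity ρ({y,z}), as does the prefix of P up to z.
-- Hence vlevel({y,z}) ≤ |Q| + |P|.  Finally {y,z} is an incoming edge: the
-- only tree edge leaving T(t) joins t to its parent, and the last edge of P
-- has the wrong ρ to be that edge.

open import Defs
open import Data.Nat using (ℕ; suc; _+_; _≤_; _<_; s≤s; z≤n)
open import Data.Nat.Properties
  using ( ≤-refl; ≤-trans; <⇒≤; ≤-<-trans; <-≤-trans; <-trans; <-irrefl
        ; ≤-total; m≤m+n; m<m+n; +-mono-≤; +-suc; +-identityʳ; suc-injective
        ; m≤n⇒m⊓n≡m; m≤n⇒m⊔n≡n; m≥n⇒m⊓n≡n; m≥n⇒m⊔n≡m; m⊓n≤m; m⊓n≤n )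
open import Data.Nat.Solver using (module +-*-Solver)
open +-*-Solver using (solve; _:+_; _:=_; con)
open import Data.Fin using (Fin)
open import Data.Fin.Properties using () renaming (_≟_ to _≟ᶠ_)
open import Data.Bool using (Bool; true; false; T; if_then_else_)
open import Data.List using (List; []; _∷_; _++_; [_]; length; reverse)
open import Data.List.Properties
  using (++-assoc; length-++; length-reverse; reverse-++; unfold-reverse; ∷-injectiveˡ)
open import Data.List.Relation.Unary.All as All using (All; []; _∷_; all?)
import Data.List.Relation.Unary.All.Properties as All
open import Data.List.Relation.Unary.Any using (here; there)
open import Data.List.Relation.Unary.Any.Properties using (reverse⁻)
open import Data.List.Relation.Unary.AllPairs using ([]; _∷_)
open import Data.List.Relation.Unary.Unique.Propositional using (Unique)
open import Data.List.Relation.Unary.Unique.Propositional.Properties using (++⁺)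
open import Data.List.Relation.Binary.Disjoint.Propositional using (Disjoint)
open import Data.List.Membership.Propositional using (_∈_; _∉_)
open import Data.List.Membership.Propositional.Properties using (∈-++⁺ʳ; ∈-∃++)
import Data.List.Relation.Binary.Permutation.Setoid as Permutation
import Data.List.Relation.Binary.Permutation.Setoid.Properties as PermutationProperties
open import Data.Product using (∃; ∃₂; _×_; _,_; proj₁; proj₂)
open import Data.Sum using (_⊎_; inj₁; inj₂)
open import Data.Unit using (tt)
open import Data.Empty using (⊥-elim)
open import Function using (_∘_)
open import Relation.Nullary using (¬_; Dec; yes; no)
open import Relation.Nullary.Decidable using (map′)
open import Level using (Level)
open import Relation.Unary using (Pred; Decidable)
open import Relation.Binary.Definitions using (DecidableEquality)
open import Relation.Binary.PropositionalEquality
  using (_≡_; _≢_; refl; sym; trans; cong; cong₂; subst; subst₂; module ≡-Reasoning)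
open import Relation.Binary.PropositionalEquality.Properties using (setoid)

flip-involutive : ∀ θ → flip (flip θ) ≡ θ
flip-involutive odd  = refl
flip-involutive even = refl

flip-≢ : ∀ θ → θ ≢ flip θ
flip-≢ odd  ()
flip-≢ even ()

_⊕_ : Parity → Parity → Parity
even ⊕ θ = θ
odd  ⊕ θ = flip θ

⊕-flip : ∀ π θ → π ⊕ flip θ ≡ flip π ⊕ θ
⊕-flip even θ = refl
⊕-flip odd  θ = flip-involutive θ

⊕-identityʳ : ∀ π → π ⊕ even ≡ π
⊕-identityʳ even = refl
⊕-identityʳ odd  = refl

xor⇒flip : ∀ b c → (T b × ¬ T c) ⊎ (¬ T b × T c) →
           (if c then odd else even) ≡ flip (if b then odd else even)
xor⇒flip true  false _                = refl
xor⇒flip false true  _                = refl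
xor⇒flip true  true  (inj₁ (_ , ¬c)) = ⊥-elim (¬c tt)
xor⇒flip true  true  (inj₂ (¬b , _)) = ⊥-elim (¬b tt)
xor⇒flip false false (inj₁ (() , _))
xor⇒flip false false (inj₂ (_ , ()))

flip⇒xor : ∀ b c → (if c then odd else even) ≡ flip (if b then odd else even) →
           (T b × ¬ T c) ⊎ (¬ T b × T c)
flip⇒xor true  false _ = inj₁ (tt , λ ())
flip⇒xor false true  _ = inj₂ ((λ ()) , tt)
flip⇒xor true  true  ()
flip⇒xor false false ()

fin-injective : ∀ {a b} → fin a ≡ fin b → a ≡ b
fin-injective refl = refl

isFin? : ∀ x → Dec (IsFin x)
isFin? (fin _) = yes tt
isFin? ∞       = no λ ()

≤fin⇒IsFin : ∀ {x a} → x ≤∞ fin a → IsFin x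
≤fin⇒IsFin (fin≤fin _) = tt

<∞⇒IsFin : ∀ {x y} → x <∞ y → IsFin x
<∞⇒IsFin (fin<fin _) = tt
<∞⇒IsFin fin<∞       = tt

≤∞-reflexive : ∀ {x y} → x ≡ y → x ≤∞ y
≤∞-reflexive {fin _} refl = fin≤fin ≤-refl
≤∞-reflexive {∞}     refl = ∞ ≤∞∞

≤∞-trans : ∀ {x y z} → x ≤∞ y → y ≤∞ z → x ≤∞ z
≤∞-trans (fin≤fin p) (fin≤fin q) = fin≤fin (≤-trans p q)
≤∞-trans _           (_ ≤∞∞)     = _ ≤∞∞

<∞⇒≤∞ : ∀ {x y} → x <∞ y → x ≤∞ y
<∞⇒≤∞ (fin<fin p) = fin≤fin (<⇒≤ p)
<∞⇒≤∞ fin<∞       = _ ≤∞∞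

<∞-trans : ∀ {x y z} → x <∞ y → y <∞ z → x <∞ z
<∞-trans (fin<fin p) (fin<fin q) = fin<fin (<-trans p q)
<∞-trans (fin<fin p) fin<∞       = fin<∞

≤∞-<∞-trans : ∀ {x y z} → x ≤∞ y → y <∞ z → x <∞ z
≤∞-<∞-trans (fin≤fin p) (fin<fin q) = fin<fin (≤-<-trans p q)
≤∞-<∞-trans (fin≤fin p) fin<∞       = fin<∞

<∞-≤∞-trans : ∀ {x y z} → x <∞ y → y ≤∞ z → x <∞ z
<∞-≤∞-trans (fin<fin p) (fin≤fin q) = fin<fin (<-≤-trans p q)
<∞-≤∞-trans (fin<fin p) (_ ≤∞∞)     = fin<∞
<∞-≤∞-trans fin<∞       (_ ≤∞∞)     = fin<∞

<∞-irrefl : ∀ {x} → ¬ x <∞ x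
<∞-irrefl (fin<fin p) = <-irrefl refl p

min∞-≤ˡ : ∀ x y → min∞ x y ≤∞ x
min∞-≤ˡ (fin a) (fin b) = fin≤fin (m⊓n≤m a b)
min∞-≤ˡ (fin a) ∞       = fin≤fin ≤-refl
min∞-≤ˡ ∞       y       = y ≤∞∞

min∞-≤ʳ : ∀ x y → min∞ x y ≤∞ y
min∞-≤ʳ (fin a) (fin b) = fin≤fin (m⊓n≤n a b)
min∞-≤ʳ (fin a) ∞       = _ ≤∞∞
min∞-≤ʳ ∞       y       = ≤∞-reflexive refl

+-rearrange : ∀ a b c → a + b + c + 1 ≡ a + (c + (b + 1))
+-rearrange = solve 3 (λ a b c → a :+ b :+ c :+ con 1 := a :+ (c :+ (b :+ con 1))) refl

+∞-mono-≤ : ∀ {x y a b} → x ≤∞ fin a → y ≤∞ fin b → (x +∞ y) ≤∞ fin (a + b)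
+∞-mono-≤ (fin≤fin p) (fin≤fin q) = fin≤fin (+-mono-≤ p q)

+∞-∞ʳ : ∀ x {y} → ¬ IsFin y → x +∞ y ≡ ∞
+∞-∞ʳ x       {fin _} y∞ = ⊥-elim (y∞ tt)
+∞-∞ʳ (fin _) {∞}     _  = refl
+∞-∞ʳ ∞       {∞}     _  = refl

module _ {a : Level} {A : Set a} where

  split-last-¬ : ∀ {p} {P : Pred A p} → Decidable P → ∀ xs → ¬ All P xs →
                 ∃ λ Z → ∃₂ λ z X → xs ≡ Z ++ z ∷ X × ¬ P z × All P X
  split-last-¬ P? []       ¬all = ⊥-elim (¬all [])
  split-last-¬ P? (x ∷ xs) ¬all with all? P? xs
  ... | yes all = [] , x , xs , refl , (λ px → ¬all (px ∷ all)) , all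
  ... | no ¬all′ with split-last-¬ P? xs ¬all′
  ...   | Z , z , X , refl , ¬pz , all = x ∷ Z , z , X , refl , ¬pz , all

  ∷ʳ-uncons : ∀ (xs : List A) x → ∃₂ λ y ys → xs ++ [ x ] ≡ y ∷ ys
  ∷ʳ-uncons []       x = x , [] , refl
  ∷ʳ-uncons (y ∷ xs) x = y , xs ++ [ x ] , refl

  length-∷≡++ : ∀ {y : A} {ys} us {x zs} → y ∷ ys ≡ us ++ x ∷ zs →
                length ys ≡ length us + length zs
  length-∷≡++ {ys = ys} us {x} {zs} eq = suc-injective (begin
    suc (length ys)             ≡⟨ cong length eq ⟩
    length (us ++ x ∷ zs)       ≡⟨ length-++ us ⟩
    length us + suc (length zs) ≡⟨ +-suc (length us) (length zs) ⟩
    suc (length us + length zs) ∎)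
    where open ≡-Reasoning

  ∷-prefix : ∀ {y : A} {ys} us {x zs} → y ∷ ys ≡ us ++ x ∷ zs →
             ∃ λ vs → y ∷ vs ≡ us ++ [ x ]
  ∷-prefix []       eq = [] , cong [_] (∷-injectiveˡ eq)
  ∷-prefix (u ∷ us) {x} eq = us ++ [ x ] , cong (_∷ us ++ [ x ]) (∷-injectiveˡ eq)

  head∈init : ∀ {y : A} {ys} us {x} → y ∷ ys ≡ us ++ [ x ] → x ≢ y → y ∈ us
  head∈init []      eq x≢y = ⊥-elim (x≢y (sym (∷-injectiveˡ eq)))
  head∈init (_ ∷ _) eq _   = here (∷-injectiveˡ eq)

  Unique-++⁻ˡ : ∀ xs {ys : List A} → Unique (xs ++ ys) → Unique xs
  Unique-++⁻ˡ []       _          = []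
  Unique-++⁻ˡ (x ∷ xs) (x∉ ∷ uxs) = All.++⁻ˡ xs x∉ ∷ Unique-++⁻ˡ xs uxs

  Unique-++⁻ʳ : ∀ xs {ys : List A} → Unique (xs ++ ys) → Unique ys
  Unique-++⁻ʳ []       u         = u
  Unique-++⁻ʳ (_ ∷ xs) (_ ∷ uxs) = Unique-++⁻ʳ xs uxs

  Unique-∷ʳ⇒∉ : ∀ xs {x : A} → Unique (xs ++ [ x ]) → x ∉ xs
  Unique-∷ʳ⇒∉ (y ∷ xs) (y∉ ∷ _) (here refl) = All.lookup y∉ (∈-++⁺ʳ xs (here refl)) refl
  Unique-∷ʳ⇒∉ (_ ∷ xs) (_ ∷ u)  (there x∈)  = Unique-∷ʳ⇒∉ xs u x∈

  Unique-∷ʳ-head : ∀ xs {x : A} {ys} → Unique (xs ++ [ x ]) → xs ++ [ x ] ≡ x ∷ ys → xs ≡ []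
  Unique-∷ʳ-head []       _ _  = refl
  Unique-∷ʳ-head (y ∷ xs) u eq = ⊥-elim (Unique-∷ʳ⇒∉ (y ∷ xs) u (here (sym (∷-injectiveˡ eq))))

  Unique-reverse : ∀ {xs : List A} → Unique xs → Unique (reverse xs)
  Unique-reverse {xs} = Unique-resp-↭ (↭-sym (↭-reverse xs))
    where
      open Permutation (setoid A) using (↭-sym)
      open PermutationProperties (setoid A) using (Unique-resp-↭; ↭-reverse)

-- Alternating walks in G⁺

_≟ᵥ_ : ∀ {n} → DecidableEquality (V⁺ n)
orig a ≟ᵥ orig b = map′ (cong orig) (λ { refl → refl }) (a ≟ᶠ b)
orig _ ≟ᵥ f      = no λ ()
orig _ ≟ᵥ w _    = no λ ()
f      ≟ᵥ orig _ = no λ ()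
f      ≟ᵥ f      = yes refl
f      ≟ᵥ w _    = no λ ()
w _    ≟ᵥ orig _ = no λ ()
w _    ≟ᵥ f      = no λ ()
w a    ≟ᵥ w b    = map′ (cong w) (λ { refl → refl }) (a ≟ᶠ b)

module _ {n : ℕ} (adj mat : Fin n → Fin n → Bool)
         (adj-sym : ∀ a b → adj a b ≡ adj b a) (mat-sym : ∀ a b → mat a b ≡ mat b a) where

  E⁺-sym : ∀ x y → E⁺ adj mat x y ≡ E⁺ adj mat y x
  E⁺-sym (orig a) (orig b) = adj-sym a b
  E⁺-sym (orig _) f        = refl
  E⁺-sym (orig _) (w _)    = refl
  E⁺-sym f        (orig _) = refl
  E⁺-sym f        f        = refl
  E⁺-sym f        (w _)    = refl
  E⁺-sym (w _)    (orig _) = refl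
  E⁺-sym (w _)    f        = refl
  E⁺-sym (w _)    (w _)    = refl

  M⁺-sym : ∀ x y → M⁺ adj mat x y ≡ M⁺ adj mat y x
  M⁺-sym (orig a) (orig b) = mat-sym a b
  M⁺-sym (orig _) f        = refl
  M⁺-sym (orig _) (w _)    = refl
  M⁺-sym f        (orig _) = refl
  M⁺-sym f        f        = refl
  M⁺-sym f        (w _)    = refl
  M⁺-sym (w _)    (orig _) = refl
  M⁺-sym (w _)    f        = refl
  M⁺-sym (w _)    (w _)    = refl

  ρ-sym : ∀ x y → ρ adj mat x y ≡ ρ adj mat y x
  ρ-sym x y = cong (if_then odd else even) (M⁺-sym x y)

  -- In AltWalk θ θ′ l, θ is the ρ of the first edge of l and θ′ the ρ that an
  -- edge appended at the end of l would need.
  data AltWalk : Parity → Parity → List (V⁺ n) → Set where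
    stop : ∀ {θ x} → AltWalk θ θ [ x ]
    step : ∀ {θ θ′ x y l} → T (E⁺ adj mat x y) → ρ adj mat x y ≡ θ →
           AltWalk (flip θ) θ′ (y ∷ l) → AltWalk θ θ′ (x ∷ y ∷ l)

  AltWalk-++ : ∀ xs {a ys θ θ′ θ″} → AltWalk θ θ′ (xs ++ [ a ]) → AltWalk θ′ θ″ (a ∷ ys) →
               AltWalk θ θ″ (xs ++ a ∷ ys)
  AltWalk-++ []            stop          ω′ = ω′
  AltWalk-++ (_ ∷ [])      (step e r ω)  ω′ = step e r (AltWalk-++ [] ω ω′)
  AltWalk-++ (_ ∷ x ∷ xs)  (step e r ω)  ω′ = step e r (AltWalk-++ (x ∷ xs) ω ω′)

  AltWalk-split : ∀ xs {a ys θ θ″} → AltWalk θ θ″ (xs ++ a ∷ ys) →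
                  ∃ λ θ′ → AltWalk θ θ′ (xs ++ [ a ]) × AltWalk θ′ θ″ (a ∷ ys)
  AltWalk-split []           ω            = _ , stop , ω
  AltWalk-split (_ ∷ [])     (step e r ω) = _ , step e r stop , ω
  AltWalk-split (_ ∷ x ∷ xs) (step e r ω) with AltWalk-split (x ∷ xs) ω
  ... | θ′ , ω₁ , ω₂ = θ′ , step e r ω₁ , ω₂

  AltWalk-reverse : ∀ {θ θ′ l} → AltWalk θ θ′ l → AltWalk (flip θ′) (flip θ) (reverse l)
  AltWalk-reverse stop = stop
  AltWalk-reverse {θ} {θ′} (step {x = x} {y} {l} e r ω) =
    subst (AltWalk (flip θ′) (flip θ)) (sym reverse-x∷y∷l)
      (AltWalk-++ (reverse l) back (step (subst T (E⁺-sym x y) e) (trans (ρ-sym y x) r) stop))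
    where
      open ≡-Reasoning
      reverse-x∷y∷l : reverse (x ∷ y ∷ l) ≡ reverse l ++ y ∷ x ∷ []
      reverse-x∷y∷l = begin
        reverse (x ∷ y ∷ l)           ≡⟨ unfold-reverse x (y ∷ l) ⟩
        reverse (y ∷ l) ++ [ x ]      ≡⟨ cong (_++ [ x ]) (unfold-reverse y l) ⟩
        (reverse l ++ [ y ]) ++ [ x ] ≡⟨ ++-assoc (reverse l) [ y ] [ x ] ⟩
        reverse l ++ y ∷ x ∷ []       ∎
      back : AltWalk (flip θ′) θ (reverse l ++ [ y ])
      back = subst₂ (AltWalk (flip θ′)) (flip-involutive θ) (unfold-reverse y l) (AltWalk-reverse ω)

  last-edge-ρ : ∀ {θ θ′ x y} → AltWalk θ θ′ (x ∷ y ∷ []) → ρ adj mat x y ≡ flip θ′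
  last-edge-ρ {θ} (step _ r stop) = trans r (sym (flip-involutive θ))

  AltWalk-parity : ∀ {θ θ′ x xs} → AltWalk θ θ′ (x ∷ xs) → θ′ ≡ parityOf (length xs) ⊕ θ
  AltWalk-parity stop = refl
  AltWalk-parity {θ} (step {l = l} _ _ ω) = trans (AltWalk-parity ω) (⊕-flip (parityOf (length l)) θ)

  AltWalk-even-parity : ∀ {θ x xs} → AltWalk even θ (x ∷ xs) → parityOf (length xs) ≡ θ
  AltWalk-even-parity {xs = xs} ω = sym (trans (AltWalk-parity ω) (⊕-identityʳ (parityOf (length xs))))

  AltWalk⇒Edges : ∀ {θ θ′ l} → AltWalk θ θ′ l → Edges adj mat l
  AltWalk⇒Edges stop         = tt
  AltWalk⇒Edges (step e _ ω) = e , AltWalk⇒Edges ω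

  AltWalk⇒Alternates : ∀ {θ θ′ l} → AltWalk θ θ′ l → Alternates adj mat l
  AltWalk⇒Alternates stop                             = tt
  AltWalk⇒Alternates (step _ _ stop)                  = tt
  AltWalk⇒Alternates (step {x = x} {y} _ r ω@(step {y = z} _ r′ _)) =
    flip⇒xor (M⁺ adj mat x y) (M⁺ adj mat y z) (trans r′ (cong flip (sym r))) , AltWalk⇒Alternates ω

  Alternates⇒AltWalk : ∀ {x y l} → Edges adj mat (x ∷ y ∷ l) → Alternates adj mat (x ∷ y ∷ l) →
                       ∃ λ θ′ → AltWalk (ρ adj mat x y) θ′ (x ∷ y ∷ l)
  Alternates⇒AltWalk {l = []}    (e , _)  _        = _ , step e refl stop
  Alternates⇒AltWalk {x} {y} {z ∷ l} (e , es) (a , as) with Alternates⇒AltWalk es as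
  ... | θ′ , ω = θ′ , step e refl
                   (subst (λ θ → AltWalk θ θ′ (y ∷ z ∷ l)) (xor⇒flip (M⁺ adj mat x y) (M⁺ adj mat y z) a) ω)

  AltPath⇒AltWalk : ∀ {v q} → AltPath adj mat v q → AltWalk even (parityOf (length q)) (f ∷ q)
  AltPath⇒AltWalk {q = []}    _                = stop
  AltPath⇒AltWalk {q = y ∷ l} (_ , es , as , _) with Alternates⇒AltWalk es as
  -- ρ f y reduces to even, since no edge of M⁺ meets f.
  ... | _ , ω = subst (λ θ → AltWalk even θ (f ∷ y ∷ l)) (sym (AltWalk-even-parity ω)) ω

  AltWalk⇒AltPath : ∀ {θ v q pre} → f ∷ q ≡ pre ++ [ v ] → AltWalk even θ (f ∷ q) → Unique (f ∷ q) →
                    AltPath adj mat v q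
  AltWalk⇒AltPath end ω u = (_ , end) , AltWalk⇒Edges ω , AltWalk⇒Alternates ω , u

  module _ (dist : Parity → V⁺ n → ℕ∞) (isDist : ∀ θ v → IsDist adj mat θ v (dist θ v)) where

    distα≤dist : ∀ θ v → distα adj mat dist v ≤∞ dist θ v
    distα≤dist odd  v = min∞-≤ˡ (dist odd v) (dist even v)
    distα≤dist even v = min∞-≤ʳ (dist odd v) (dist even v)

    dist-≤ : ∀ {θ v q pre} → f ∷ q ≡ pre ++ [ v ] → AltWalk even θ (f ∷ q) → Unique (f ∷ q) →
             dist θ v ≤∞ fin (length q)
    dist-≤ {θ} {v} {q} end ω u with dist θ v | isDist θ v
    ... | fin _ | _ , minimal = fin≤fin (minimal q (AltWalk⇒AltPath end ω u) (AltWalk-even-parity ω))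
    ... | ∞     | none        = ⊥-elim (none q (AltWalk⇒AltPath end ω u) (AltWalk-even-parity ω))

    dist-≤-prefix : ∀ {θ q} u {x} rest → f ∷ q ≡ u ++ x ∷ rest →
                    AltWalk even θ (f ∷ q) → Unique (f ∷ q) →
                    ∃ λ θx → dist θx x ≤∞ fin (length u) × AltWalk θx θ (x ∷ rest)
    dist-≤-prefix {θ} u {x} rest split ω uq
      with AltWalk-split u (subst (AltWalk even θ) split ω) | ∷-prefix u split
    ... | θx , ω-init , ω-rest | q′ , init =
      θx , subst (λ k → dist θx x ≤∞ fin k) |q′|≡|u| (dist-≤ init ω′ u′) , ω-rest
      where
        |q′|≡|u| : length q′ ≡ length u
        |q′|≡|u| = trans (length-∷≡++ u init) (+-identityʳ (length u))
        ω′ : AltWalk even θx (f ∷ q′)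
        ω′ = subst (AltWalk even θx) (sym init) ω-init
        u′ : Unique (f ∷ q′)
        u′ = subst Unique (sym init)
               (Unique-++⁻ˡ (u ++ [ x ]) (subst Unique (trans split (sym (++-assoc u [ x ] rest))) uq))

    distα-≤-prefix : ∀ {θ q} u {x} rest → f ∷ q ≡ u ++ x ∷ rest →
                     AltWalk even θ (f ∷ q) → Unique (f ∷ q) →
                     distα adj mat dist x ≤∞ fin (length u)
    distα-≤-prefix u {x} rest split ω uq with dist-≤-prefix u rest split ω uq
    ... | θx , x-dist , _ = ≤∞-trans (distα≤dist θx x) x-dist

    distα-distβ-paths : ∀ v → IsFin (distβ adj mat dist v) →
      ∃₂ λ q p → AltPath adj mat v q × AltPath adj mat v p
               × fin (length q) ≡ distα adj mat dist v × fin (length p) ≡ distβ adj mat dist v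
               × parityOf (length p) ≡ flip (parityOf (length q))
    distα-distβ-paths v = paths (dist odd v) (dist even v) (isDist odd v) (isDist even v)
      where
        paths : ∀ o e → IsDist adj mat odd v o → IsDist adj mat even v e → IsFin (max∞ o e) →
          ∃₂ λ q p → AltPath adj mat v q × AltPath adj mat v p
                   × fin (length q) ≡ min∞ o e × fin (length p) ≡ max∞ o e
                   × parityOf (length p) ≡ flip (parityOf (length q))
        paths (fin a) (fin b) ((q , Q , refl , q-odd) , _) ((p , P , refl , p-even) , _) _
          with ≤-total a b
        ... | inj₁ a≤b = q , p , Q , P , cong fin (sym (m≤n⇒m⊓n≡m a≤b)) , cong fin (sym (m≤n⇒m⊔n≡n a≤b))
                       , trans p-even (cong flip (sym q-odd))
        ... | inj₂ b≤a = p , q , P , Q , cong fin (sym (m≥n⇒m⊓n≡n b≤a)) , cong fin (sym (m≥n⇒m⊔n≡m b≤a))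
                       , trans q-odd (cong flip (sym p-even))
        paths (fin _) ∞ _ _ ()
        paths ∞       _ _ _ ()

    vlevel-≤ : ∀ {θ y z a b} → ρ adj mat y z ≡ θ → dist θ y ≤∞ fin a → dist θ z ≤∞ fin b →
               vlevel adj mat dist y z ≤∞ fin (a + b + 1)
    vlevel-≤ refl y-dist z-dist = +∞-mono-≤ (+∞-mono-≤ y-dist z-dist) (fin≤fin ≤-refl)

    LevelLE⇒vlevel-≤ : ∀ {y z y′ z′} → LevelLE adj mat dist y z y′ z′ →
                       vlevel adj mat dist y z ≤∞ vlevel adj mat dist y′ z′
    LevelLE⇒vlevel-≤ (inj₁ lt)      = <∞⇒≤∞ lt
    LevelLE⇒vlevel-≤ (inj₂ (eq , _)) = ≤∞-reflexive eq

    -- Subtrees of an ABT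

    module _ (par : V⁺ n → V⁺ n) (abt : IsABT adj mat dist par) where

      ¬Desc-f : ∀ {t} → t ≢ f → ¬ Desc adj mat dist par t f
      ¬Desc-f t≢f here        = t≢f refl
      ¬Desc-f _   (there f≢f _) = f≢f refl

      Desc-parent : ∀ {t v} → Desc adj mat dist par t v → v ≢ t → Desc adj mat dist par t (par v)
      Desc-parent here        v≢t = ⊥-elim (v≢t refl)
      Desc-parent (there _ d) _   = d

      Desc? : ∀ {t v} → t ≢ f → Desc adj mat dist par f v → Dec (Desc adj mat dist par t v)
      Desc? t≢f here = no (¬Desc-f t≢f)
      Desc? {t} t≢f (there {v} v≢f d) with v ≟ᵥ t | Desc? t≢f d
      ... | yes refl | _      = yes here
      ... | no _     | yes d′ = yes (there v≢f d′)
      ... | no v≢t   | no ¬d′ = no λ { here → v≢t refl ; (there _ d′) → ¬d′ d′ }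

      Sub? : ∀ {t} → t ≢ f → Decidable (Sub adj mat dist par t)
      Sub? t≢f v with isFin? (distα adj mat dist v)
      ... | no v∉T  = no (v∉T ∘ proj₁)
      ... | yes v∈T = map′ (v∈T ,_) proj₂ (Desc? t≢f (proj₂ abt v v∈T))

      distα-parent-< : ∀ {v} → InT adj mat dist v → v ≢ f →
                       distα adj mat dist (par v) <∞ distα adj mat dist v
      distα-parent-< {v} v∈T v≢f with proj₁ abt v v∈T v≢f
      ... | r , R@(_ , _ , _ , r-unique) , r-min , pre , r-end =
        ≤∞-<∞-trans (distα-≤-prefix pre [ v ] r-end (AltPath⇒AltWalk R) r-unique)
                    (subst (fin (length pre) <∞_) r-min (fin<fin |pre|<|r|))
        where
          |pre|<|r| : length pre < length r
          |pre|<|r| = subst (length pre <_) (sym (length-∷≡++ pre r-end)) (m<m+n (length pre) (s≤s z≤n))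

      Desc⇒distα-< : ∀ {t v} → Desc adj mat dist par t v → InT adj mat dist v →
                     v ≡ t ⊎ distα adj mat dist t <∞ distα adj mat dist v
      Desc⇒distα-< here _ = inj₁ refl
      Desc⇒distα-< (there v≢f d) v∈T with distα-parent-< v∈T v≢f
      ... | parent< with Desc⇒distα-< d (<∞⇒IsFin parent<)
      ...   | inj₁ refl     = inj₂ parent<
      ...   | inj₂ t<parent = inj₂ (<∞-trans t<parent parent<)

      shortest-path∩subtree : ∀ {t q x} → AltPath adj mat t q → fin (length q) ≡ distα adj mat dist t →
                              x ∈ f ∷ q → Sub adj mat dist par t x → x ≡ t
      shortest-path∩subtree {t} {x = x} Q@(_ , _ , _ , q-unique) q-min x∈Q (x∈T , t→x)
        with ∈-∃++ x∈Q | Desc⇒distα-< t→x x∈T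
      ... | _ , _ , _     | inj₁ x≡t = x≡t
      ... | u , rest , split | inj₂ t<x = ⊥-elim (<∞-irrefl (<∞-≤∞-trans t<x x≤t))
        where
          x≤t : distα adj mat dist x ≤∞ distα adj mat dist t
          x≤t = ≤∞-trans (distα-≤-prefix u rest split (AltPath⇒AltWalk Q) q-unique)
                         (subst (fin (length u) ≤∞_) q-min
                           (fin≤fin (subst (length u ≤_) (sym (length-∷≡++ u split)) (m≤m+n _ _))))

      parent-edge-ρ : ∀ {t q} → t ≢ f → AltPath adj mat t q → fin (length q) ≡ distα adj mat dist t →
                      ρ adj mat (par t) t ≡ flip (parityOf (length q))
      parent-edge-ρ {t} t≢f Q q-min with proj₁ abt t (subst IsFin q-min tt) t≢f
      ... | r , R@(_ , _ , _ , r-unique) , r-min , pre , r-end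
        with dist-≤-prefix pre [ t ] r-end (AltPath⇒AltWalk R) r-unique
      ...   | _ , _ , last = trans (last-edge-ρ last)
                                   (cong (flip ∘ parityOf) (fin-injective (trans r-min (sym q-min))))

      last-edge-not-parent : ∀ {t q θ z} → t ≢ f → AltPath adj mat t q →
                             fin (length q) ≡ distα adj mat dist t →
                             AltWalk θ (flip (parityOf (length q))) (z ∷ t ∷ []) → par t ≢ z
      last-edge-not-parent {t} {q} {z = z} t≢f Q q-min last pt≡z = flip-≢ π (begin
        π                   ≡⟨ sym (flip-involutive π) ⟩
        flip (flip π)       ≡⟨ sym (last-edge-ρ last) ⟩
        ρ adj mat z t       ≡⟨ cong (λ v → ρ adj mat v t) (sym pt≡z) ⟩
        ρ adj mat (par t) t ≡⟨ parent-edge-ρ t≢f Q q-min ⟩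
        flip π              ∎)
        where
          open ≡-Reasoning
          π : Parity
          π = parityOf (length q)

      TreeEdge-leaving-subtree : ∀ {t y z} → Sub adj mat dist par t y → ¬ Sub adj mat dist par t z →
                         InT adj mat dist z → TreeEdge adj mat dist par y z → y ≡ t × par t ≡ z
      TreeEdge-leaving-subtree {t} (_ , t→y) z∉T z∈T (inj₁ (_ , z≢f , pz≡y)) =
        ⊥-elim (z∉T (z∈T , there z≢f (subst (Desc adj mat dist par t) (sym pz≡y) t→y)))
      TreeEdge-leaving-subtree {t} {y} (_ , t→y) z∉T z∈T (inj₂ (_ , _ , py≡z)) with y ≟ᵥ t
      ... | yes refl = refl , py≡z
      ... | no y≢t   = ⊥-elim (z∉T (z∈T , subst (Desc adj mat dist par t) py≡z (Desc-parent t→y y≢t)))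

      dist-via-tail : ∀ {t q θz X y Y} → AltPath adj mat t q → fin (length q) ≡ distα adj mat dist t →
                      X ++ [ t ] ≡ y ∷ Y → Unique (X ++ [ t ]) → All (Sub adj mat dist par t) X →
                      AltWalk (flip θz) (flip (parityOf (length q))) (y ∷ Y) →
                      dist θz y ≤∞ fin (length q + length X)
      dist-via-tail {t} {q} {θz} {X} {y} {Y} Q@((preQ , q-end) , _ , _ , q-unique) q-min
                    tail≡ tail-unique X⊆T tail =
        subst (λ k → dist θz y ≤∞ fin k) |q++X| (dist-≤ end detour unique)
        where
          open ≡-Reasoning
          path≡ : f ∷ q ++ reverse X ≡ preQ ++ t ∷ reverse X
          path≡ = trans (cong (_++ reverse X) q-end) (++-assoc preQ [ t ] (reverse X))
          reverse-tail : reverse (y ∷ Y) ≡ t ∷ reverse X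
          reverse-tail = trans (cong reverse (sym tail≡)) (reverse-++ X [ t ])
          back : AltWalk (parityOf (length q)) θz (t ∷ reverse X)
          back = subst₂ (λ θ θ′ → AltWalk θ θ′ (t ∷ reverse X)) (flip-involutive _) (flip-involutive θz)
                        (subst (AltWalk _ _) reverse-tail (AltWalk-reverse tail))
          detour : AltWalk even θz (f ∷ q ++ reverse X)
          detour = subst (AltWalk even θz) (sym path≡)
                     (AltWalk-++ preQ (subst (AltWalk even _) q-end (AltPath⇒AltWalk Q)) back)
          end : f ∷ q ++ reverse X ≡ (preQ ++ reverse Y) ++ [ y ]
          end = begin
            f ∷ q ++ reverse X           ≡⟨ path≡ ⟩
            preQ ++ t ∷ reverse X        ≡⟨ cong (preQ ++_) reverse-tail ⟨
            preQ ++ reverse (y ∷ Y)      ≡⟨ cong (preQ ++_) (unfold-reverse y Y) ⟩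
            preQ ++ reverse Y ++ [ y ]   ≡⟨ ++-assoc preQ (reverse Y) [ y ] ⟨
            (preQ ++ reverse Y) ++ [ y ] ∎
          disjoint : Disjoint (f ∷ q) (reverse X)
          disjoint (v∈Q , v∈X) = Unique-∷ʳ⇒∉ X tail-unique
            (subst (_∈ X) (shortest-path∩subtree Q q-min v∈Q (All.lookup X⊆T (reverse⁻ v∈X))) (reverse⁻ v∈X))
          unique : Unique (f ∷ q ++ reverse X)
          unique = ++⁺ q-unique (Unique-reverse (Unique-++⁻ˡ X tail-unique)) disjoint
          |q++X| : length (q ++ reverse X) ≡ length q + length X
          |q++X| = trans (length-++ q) (cong (length q +_) (length-reverse X))

      last-entering-edge : ∀ {t q p} → t ≢ f → AltPath adj mat t q → fin (length q) ≡ distα adj mat dist t →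
                  AltPath adj mat t p → parityOf (length p) ≡ flip (parityOf (length q)) →
                  ∃₂ λ y z → Incoming adj mat dist par t y z
                           × vlevel adj mat dist y z ≤∞ fin (length q + length p)
      last-entering-edge {t} {q} {p} t≢f Q q-min P@((preP , p-end) , _ , _ , p-unique) p-parity
        with split-last-¬ (Sub? t≢f) preP
               (λ all → ¬Desc-f t≢f (proj₂ (All.lookup all (head∈init preP p-end t≢f))))
      ... | Z , z , X , refl , z∉T , X⊆T
        with ∷ʳ-uncons X t
           | dist-≤-prefix Z (X ++ [ t ]) (trans p-end (++-assoc Z (z ∷ X) [ t ]))
               (subst (λ π → AltWalk even π (f ∷ p)) p-parity (AltPath⇒AltWalk P)) p-unique
      ... | y , Y , tail≡ | θz , z-dist , ω with subst (λ l → AltWalk θz _ (z ∷ l)) tail≡ ω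
      ... | step z-y ρzy tail = y , z , (y-z , not-tree , y∈T , z∉T) , vlevel-bound
        where
          p-split : f ∷ p ≡ Z ++ z ∷ X ++ [ t ]
          p-split = trans p-end (++-assoc Z (z ∷ X) [ t ])
          tail-unique : Unique (X ++ [ t ])
          tail-unique with Unique-++⁻ʳ Z (subst Unique p-split p-unique)
          ... | _ ∷ u = u
          y∈T : Sub adj mat dist par t y
          y∈T = All.head (subst (All (Sub adj mat dist par t)) tail≡
                                (All.++⁺ X⊆T ((subst IsFin q-min tt , here) ∷ [])))
          z∈T : InT adj mat dist z
          z∈T = ≤fin⇒IsFin (≤∞-trans (distα≤dist θz z) z-dist)
          y-z : T (E⁺ adj mat y z)
          y-z = subst T (E⁺-sym z y) z-y
          not-tree : ¬ TreeEdge adj mat dist par y z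
          not-tree te with TreeEdge-leaving-subtree y∈T z∉T z∈T te
          ... | y≡t , pt≡z = last-edge-not-parent t≢f Q q-min last pt≡z
            where
              X≡[] : X ≡ []
              X≡[] = Unique-∷ʳ-head X tail-unique (trans tail≡ (cong (_∷ Y) y≡t))
              last : AltWalk θz (flip (parityOf (length q))) (z ∷ t ∷ [])
              last = subst (λ l → AltWalk θz _ (z ∷ l ++ [ t ])) X≡[] ω
          lengths : length q + length X + length Z + 1 ≡ length q + length p
          lengths = trans (+-rearrange (length q) (length X) (length Z))
                          (cong (length q +_) (sym (trans (length-∷≡++ Z p-split) (cong (length Z +_) (length-++ X)))))
          vlevel-bound : vlevel adj mat dist y z ≤∞ fin (length q + length p)
          vlevel-bound = subst (λ k → vlevel adj mat dist y z ≤∞ fin k) lengths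
            (vlevel-≤ (trans (ρ-sym y z) ρzy) (dist-via-tail Q q-min tail≡ tail-unique X⊆T tail) z-dist)

lemma3 : (n : ℕ) (adj mat : Fin n → Fin n → Bool)
    → IsSimpleGraph adj → IsMatching adj mat
    → (dist : Parity → V⁺ n → ℕ∞)
    → (∀ θ v → IsDist adj mat θ v (dist θ v))
    → (par : V⁺ n → V⁺ n) → IsABT adj mat dist par
    → (t : V⁺ n) → InT adj mat dist t → t ≢ f
    → (y z : V⁺ n) → MinIncoming adj mat dist par t y z
    → vlevel adj mat dist y z ≤∞ (distα adj mat dist t +∞ distβ adj mat dist t)
lemma3 n adj mat (adj-sym , _) (_ , mat-sym , _) dist isDist par abt t _ t≢f y z (_ , minimal)
  with isFin? (distβ adj mat dist t)
... | no β-infinite =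
  subst (vlevel adj mat dist y z ≤∞_) (sym (+∞-∞ʳ (distα adj mat dist t) β-infinite)) (_ ≤∞∞)
... | yes β-finite with distα-distβ-paths adj mat adj-sym mat-sym dist isDist t β-finite
...   | q , p , Q , P , α≡ , β≡ , parities
  with last-entering-edge adj mat adj-sym mat-sym dist isDist par abt t≢f Q α≡ P parities
...     | y′ , z′ , incoming , bound =
  subst (vlevel adj mat dist y z ≤∞_) (cong₂ _+∞_ α≡ β≡)
        (≤∞-trans (LevelLE⇒vlevel-≤ adj mat adj-sym mat-sym dist isDist (minimal y′ z′ incoming)) bound)
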